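{- Let $G$ be a twin-free finite simple graph and let $t \geq 1$. (i) If $G = K_1$, then $\det(G) = 0$ and $\det(\mu_t(G)) = t$. (ii) If $G$ is of the form $H + K_1$ (disjoint union) for some graph $H$ with at least one edge, then $\det(\mu_t(G)) = \det(G) + t - 1$.
   Context: Two vertices are twins if they have the same open neighborhood; a graph is twin-free if it has no pair of distinct twin vertices. For a finite simple graph $G$ with $V(G)=\{v_1,\dots,v_n\}$ and $t\ge 1$, the generalized Mycielskian $\mu_t(G)$ has vertex set $\{u_i^s : 1\le i\le n,\ 0\le s\le t\}\cup\{w\}$, where $u_i^0=v_i$. For each edge $v_iv_j$ of $G$, $\mu_t(G)$ has the edge $u_i^0u_j^0$ and the edges $u_i^su_j^{s+1}$ and $u_j^su_i^{s+1}$ for $0\le s<t$; in addition $u_i^t w$ is an edge for every $i$. There are no other edges. A subset $S$ of the vertex set is a determining set if the only automorphism fixing every vertex of $S$ is the identity; $\det(G)$ is the minimum size of a determining set of $G$. -}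

module Defs where

open import Data.Nat using (ℕ; zero; suc; _+_; _*_; _≤_; _≡ᵇ_)
open import Data.Bool using (Bool; true; false; _∧_; _∨_)
open import Data.Fin using (Fin; zero; suc; toℕ; remQuot)
open import Data.Fin.Subset using (Subset; _∈_; ∣_∣)
open import Data.Product using (Σ; _×_; _,_; ∃)
open import Relation.Binary.PropositionalEquality using (_≡_)

Graph : ℕ → Set
Graph n = Fin n → Fin n → Bool

IsSimple : ∀ {n} → Graph n → Set
IsSimple {n} G = (∀ (i j : Fin n) → G i j ≡ G j i) × (∀ (i : Fin n) → G i i ≡ false)

Twins : ∀ {n} → Graph n → Fin n → Fin n → Set
Twins {n} G i j = ∀ (k : Fin n) → G i k ≡ G j k

TwinFree : ∀ {n} → Graph n → Set
TwinFree {n} G = ∀ (i j : Fin n) → Twins G i j → i ≡ j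

HasEdge : ∀ {n} → Graph n → Set
HasEdge {n} G = Σ (Fin n) λ i → Σ (Fin n) λ j → G i j ≡ true

record Iso {n m : ℕ} (G : Graph n) (H : Graph m) : Set where
  field
    to      : Fin n → Fin m
    from    : Fin m → Fin n
    from-to : ∀ i → from (to i) ≡ i
    to-from : ∀ j → to (from j) ≡ j
    adj     : ∀ i j → H (to i) (to j) ≡ G i j

Automorphism : ∀ {n} → Graph n → Set
Automorphism G = Iso G G

Determining : ∀ {n} → Graph n → Subset n → Set
Determining {n} G S =
  ∀ (σ : Automorphism G) → (∀ (v : Fin n) → v ∈ S → Iso.to σ v ≡ v) →
  ∀ (v : Fin n) → Iso.to σ v ≡ v

IsDet : ∀ {n} → Graph n → ℕ → Set
IsDet {n} G d =
  (Σ (Subset n) λ S → Determining G S × ∣ S ∣ ≡ d) ×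
  (∀ (S : Subset n) → Determining G S → d ≤ ∣ S ∣)

_+K₁ : ∀ {m} → Graph m → Graph (suc m)
(H +K₁) zero    _       = false
(H +K₁) (suc _) zero    = false
(H +K₁) (suc i) (suc j) = H i j

-- Generalized Mycielskian μ_t(G).
-- Vertex set Fin (suc (n * suc t)): zero is w; suc x with remQuot {n} (suc t) x = (i , s)
-- is u_i^s (i : Fin n, s : Fin (suc t), u_i^0 = v_i).
private
  layerAdj : ℕ → ℕ → Bool
  layerAdj s r = ((s ≡ᵇ 0) ∧ (r ≡ᵇ 0)) ∨ (r ≡ᵇ suc s) ∨ (s ≡ᵇ suc r)

μ : ∀ {n : ℕ} (t : ℕ) → Graph n → Graph (suc (n * suc t))
μ {n} t G zero    zero    = false
μ {n} t G zero    (suc y) with remQuot {n} (suc t) y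
... | (j , r) = toℕ r ≡ᵇ t
μ {n} t G (suc x) zero    with remQuot {n} (suc t) x
... | (i , s) = toℕ s ≡ᵇ t
μ {n} t G (suc x) (suc y) with remQuot {n} (suc t) x | remQuot {n} (suc t) y
... | (i , s) | (j , r) = G i j ∧ layerAdj (toℕ s) (toℕ r)

-- Let t = t₀ + 1 and let c be the isolated vertex of G.  In μ_t(G) the column of c consists of
-- t isolated vertices u_c^0, …, u_c^t₀ and a pendant vertex u_c^t hanging at w.  Any two isolated
-- vertices can be swapped, so a determining set contains all of them but at most one, and an
-- automorphism fixing all but one of them fixes all.  For G = K₁ the edge w u_c^t can be flipped
-- as well, which costs one more vertex: det μ_t(K₁) = t.  Otherwise every remaining vertex has
-- two neighbours, so every automorphism fixes u_c^t and w, preserves the distance from w and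
-- hence the layers of the other columns, and induces an automorphism of G on the base layer;
-- by twin-freeness, fixing the base layer fixes every column above it.  So a determining set of
-- μ_t(G) projects to a determining set of G, giving det G + t₀ ≤ det μ_t(G), while a determining
-- set of G placed on the base layer together with t₀ isolated vertices determines μ_t(G).

module Submission where

open import Defs
open import Data.Bool as Bool using (Bool; true; false; _∧_; _∨_)
open import Data.Bool.Properties using (∧-comm; ∨-comm; ∨-zeroʳ; ∧-identityʳ; ∧-conicalʳ; ¬-not; T-≡)
open import Data.Empty using (⊥; ⊥-elim)
open import Data.Fin as Fin
  using (Fin; zero; suc; toℕ; fromℕ; fromℕ<; inject₁; combine; remQuot; punchIn; join; splitAt)
open import Data.Fin.Properties as FinP
  using ( _≟_; any?; toℕ-injective; toℕ-fromℕ; toℕ-fromℕ<; toℕ-inject₁; toℕ-inject₁-≢; toℕ≤pred[n]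
        ; inject₁-injective; fromℕ≢inject₁; combine-remQuot; remQuot-combine; combine-injective
        ; splitAt-join; join-splitAt; injective⇒≤; punchInᵢ≢i; punchIn-injective; punchIn-punchOut )
open import Data.Fin.Permutation.Components using (transpose; transpose-inverse)
open import Data.Fin.Subset using (Subset; _∈_; _∉_; ∣_∣; inside; outside) renaming (⊥ to ∅)
open import Data.Fin.Subset.Properties using (_∈?_; ∣⊥∣≡0)
open import Data.Nat as ℕ using (ℕ; zero; suc; _+_; _*_; _∸_; _≤_; _<_; _≡ᵇ_; z≤n; s≤s)
open import Data.Nat.Properties as ℕP
  using ( ≡ᵇ⇒≡; ≤-refl; ≤-trans; ≤-antisym; n≤1+n; n∸n≡0; m∸n≡0⇒m≤n; m∸n≢0⇒n<m
        ; pred[m∸n]≡m∸[1+n]; ∸-monoʳ-≤; ∸-cancelˡ-≡ )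
open import Data.Product using (Σ; ∃-syntax; _×_; _,_; proj₁; proj₂; uncurry)
open import Data.Sum using (_⊎_; inj₁; inj₂; [_,_]′)
open import Data.Sum.Properties using (inj₁-injective)
open import Data.Vec using (_∷_; tabulate; here; there)
open import Data.Vec.Properties using (lookup∘tabulate; []=⇒lookup; lookup⇒[]=)
open import Function using (_∘_; id; flip; Equivalence)
open import Relation.Binary.PropositionalEquality
open import Relation.Nullary using (¬_; ¬?; Dec; yes; no; does; contradiction)
open import Relation.Nullary.Decidable using (dec-true; dec-false; decidable-stable; _×-dec_; _⊎-dec_)
open import Relation.Unary using (Pred; Decidable)

module _ {n : ℕ} where

  decSubset : ∀ {ℓ} {P : Pred (Fin n) ℓ} → Decidable P → Subset n
  decSubset P? = tabulate (does ∘ P?)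

  module _ {ℓ} {P : Pred (Fin n) ℓ} (P? : Decidable P) where

    ∈-decSubset⁺ : ∀ {x} → P x → x ∈ decSubset P?
    ∈-decSubset⁺ {x} px = lookup⇒[]= x _ (trans (lookup∘tabulate _ x) (dec-true (P? x) px))

    ∈-decSubset⁻ : ∀ {x} → x ∈ decSubset P? → P x
    ∈-decSubset⁻ {x} x∈ with P? x | trans (sym (lookup∘tabulate (does ∘ P?) x)) ([]=⇒lookup x∈)
    ... | yes px | _ = px

rank : ∀ {n} {p : Subset n} {x} → x ∈ p → Fin ∣ p ∣
rank {p = inside  ∷ p} here        = zero
rank {p = inside  ∷ p} (there x∈p) = suc (rank x∈p)
rank {p = outside ∷ p} (there x∈p) = rank x∈p

rank-injective : ∀ {n} {p : Subset n} {x y} (x∈p : x ∈ p) (y∈p : y ∈ p) → rank x∈p ≡ rank y∈p → x ≡ y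
rank-injective {p = inside  ∷ p} here      here      _ = refl
rank-injective {p = inside  ∷ p} (there a) (there b) e = cong suc (rank-injective a b (FinP.suc-injective e))
rank-injective {p = outside ∷ p} (there a) (there b) e = cong suc (rank-injective a b e)

enum : ∀ {n} (p : Subset n) → Fin ∣ p ∣ → Fin n
enum (inside  ∷ p) zero    = zero
enum (inside  ∷ p) (suc k) = suc (enum p k)
enum (outside ∷ p) k       = suc (enum p k)

enum-∈ : ∀ {n} (p : Subset n) (k : Fin ∣ p ∣) → enum p k ∈ p
enum-∈ (inside  ∷ p) zero    = here
enum-∈ (inside  ∷ p) (suc k) = there (enum-∈ p k)
enum-∈ (outside ∷ p) k       = there (enum-∈ p k)

enum-injective : ∀ {n} (p : Subset n) {k l} → enum p k ≡ enum p l → k ≡ l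
enum-injective (inside  ∷ p) {zero}  {zero}  _ = refl
enum-injective (inside  ∷ p) {suc k} {suc l} e = cong suc (enum-injective p (FinP.suc-injective e))
enum-injective (outside ∷ p)                 e = enum-injective p (FinP.suc-injective e)

module _ {n k : ℕ} {p : Subset n} where

  injective⇒≤∣p∣ : (f : Fin k → Fin n) → (∀ {i j} → f i ≡ f j → i ≡ j) → (∀ i → f i ∈ p) → k ≤ ∣ p ∣
  injective⇒≤∣p∣ f f-inj f∈p = injective⇒≤ (λ e → f-inj (rank-injective (f∈p _) (f∈p _) e))

  injective⇒∣p∣≤ : (f : ∀ {x} → x ∈ p → Fin k) →
                   (∀ {x y} (x∈p : x ∈ p) (y∈p : y ∈ p) → f x∈p ≡ f y∈p → x ≡ y) → ∣ p ∣ ≤ k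
  injective⇒∣p∣≤ f f-inj = injective⇒≤ (λ e → enum-injective p (f-inj (enum-∈ p _) (enum-∈ p _) e))

splitAt-injective : ∀ a {b} {k l : Fin (a + b)} → splitAt a k ≡ splitAt a l → k ≡ l
splitAt-injective a {b} {k} {l} e =
  trans (sym (join-splitAt a b k)) (trans (cong (join a b) e) (join-splitAt a b l))

join-injective : ∀ a b {x y : Fin a ⊎ Fin b} → join a b x ≡ join a b y → x ≡ y
join-injective a b {x} {y} e =
  trans (sym (splitAt-join a b x)) (trans (cong (splitAt a) e) (splitAt-join a b y))

⊎-injective⇒≤∣p∣ : ∀ {n a b} {p : Subset n} (f : Fin a ⊎ Fin b → Fin n) →
                   (∀ {x y} → f x ≡ f y → x ≡ y) → (∀ x → f x ∈ p) → a + b ≤ ∣ p ∣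
⊎-injective⇒≤∣p∣ {a = a} f f-inj f∈p =
  injective⇒≤∣p∣ (f ∘ splitAt a) (splitAt-injective a ∘ f-inj) (f∈p ∘ splitAt a)

Isolated : ∀ {N} → Graph N → Fin N → Set
Isolated {N} Γ x = ∀ (y : Fin N) → Γ x y ≡ false

adjacent⇒¬isolated : ∀ {N} {Γ : Graph N} x y → Γ x y ≡ true → ¬ Isolated Γ x
adjacent⇒¬isolated x y xy x-isolated with () ← trans (sym xy) (x-isolated y)

record UniqueNeighbour {N} (Γ : Graph N) (x z : Fin N) : Set where
  constructor uniqueNeighbour
  field
    adjacent : Γ x z ≡ true
    unique   : ∀ y → Γ x y ≡ true → y ≡ z

transpose-fixˡ : ∀ {N} (p q : Fin N) → transpose p q p ≡ q
transpose-fixˡ p q rewrite dec-true (p ≟ p) refl = refl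

transpose-fixʳ : ∀ {N} (p q : Fin N) → transpose p q q ≡ p
transpose-fixʳ p q with q ≟ p
... | yes refl = refl
... | no _ rewrite dec-true (q ≟ q) refl = refl

transpose-fix : ∀ {N} {p q x : Fin N} → x ≢ p → x ≢ q → transpose p q x ≡ x
transpose-fix {p = p} {q} {x} x≢p x≢q rewrite dec-false (x ≟ p) x≢p | dec-false (x ≟ q) x≢q = refl

data TransposeView {N} (p q : Fin N) : Fin N → Fin N → Set where
  at-p      : TransposeView p q p q
  at-q      : TransposeView p q q p
  elsewhere : ∀ {x} → x ≢ p → x ≢ q → TransposeView p q x x

transposeView : ∀ {N} (p q x : Fin N) → TransposeView p q x (transpose p q x)
transposeView p q x = view (x ≟ p) (x ≟ q)
  where
    view : Dec (x ≡ p) → Dec (x ≡ q) → TransposeView p q x (transpose p q x)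
    view (yes refl) _          = subst (TransposeView p q x) (sym (transpose-fixˡ x q)) at-p
    view (no _)     (yes refl) = subst (TransposeView p q x) (sym (transpose-fixʳ p x)) at-q
    view (no x≢p)   (no x≢q)   =
      subst (TransposeView p q x) (sym (transpose-fix x≢p x≢q)) (elsewhere x≢p x≢q)

module _ {N : ℕ} {Γ : Graph N} where
  open Iso

  isDet-intro : ∀ {d} (S : Subset N) → Determining Γ S → ∣ S ∣ ≤ d →
                (∀ S → Determining Γ S → d ≤ ∣ S ∣) → IsDet Γ d
  isDet-intro S det ∣S∣≤d lower = (S , det , ≤-antisym ∣S∣≤d (lower S det)) , lower

  Aut-injective : (σ : Automorphism Γ) → ∀ {x y} → to σ x ≡ to σ y → x ≡ y
  Aut-injective σ {x} {y} e = trans (sym (from-to σ x)) (trans (cong (from σ) e) (from-to σ y))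

  _⁻¹ : Automorphism Γ → Automorphism Γ
  σ ⁻¹ = record
    { to = from σ ; from = to σ ; from-to = to-from σ ; to-from = from-to σ
    ; adj = λ x y → trans (sym (adj σ (from σ x) (from σ y))) (cong₂ Γ (to-from σ x) (to-from σ y)) }

  adj-to-from : (σ : Automorphism Γ) → ∀ x y → Γ (to σ x) y ≡ Γ x (from σ y)
  adj-to-from σ x y = trans (cong (Γ (to σ x)) (sym (to-from σ y))) (adj σ x (from σ y))

  isolated-preserved : (σ : Automorphism Γ) → ∀ {x} → Isolated Γ x → Isolated Γ (to σ x)
  isolated-preserved σ {x} iso y = trans (adj-to-from σ x y) (iso (from σ y))

  isolated-reflected : (σ : Automorphism Γ) → ∀ {x} → Isolated Γ (to σ x) → Isolated Γ x
  isolated-reflected σ {x} σx-isolated =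
    subst (Isolated Γ) (from-to σ x) (isolated-preserved (σ ⁻¹) σx-isolated)

  uniqueNeighbour-preserved : (σ : Automorphism Γ) → ∀ {x z} → UniqueNeighbour Γ x z →
                              UniqueNeighbour Γ (to σ x) (to σ z)
  uniqueNeighbour-preserved σ {x} {z} (uniqueNeighbour xz unique) = uniqueNeighbour
    (trans (adj σ x z) xz)
    λ y e → trans (sym (to-from σ y)) (cong (to σ) (unique (from σ y) (trans (sym (adj-to-from σ x y)) e)))

  uniqueNeighbour-equal : ∀ {x z y y′} → UniqueNeighbour Γ x z → Γ x y ≡ true → Γ x y′ ≡ true → y ≡ y′
  uniqueNeighbour-equal (uniqueNeighbour _ unique) xy xy′ = trans (unique _ xy) (sym (unique _ xy′))

  uniqueNeighbour-fixed : (σ : Automorphism Γ) → ∀ {x z} → UniqueNeighbour Γ x z →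
                          to σ x ≡ x → to σ z ≡ z
  uniqueNeighbour-fixed σ xz σx≡x = UniqueNeighbour.unique xz (to σ _)
    (subst (λ v → Γ v _ ≡ true) σx≡x (UniqueNeighbour.adjacent (uniqueNeighbour-preserved σ xz)))

  determining-meets-support : ∀ {S} → Determining Γ S → (σ : Automorphism Γ) → ∀ {v} → to σ v ≢ v →
                              ∃[ x ] x ∈ S × to σ x ≢ x
  determining-meets-support {S} det σ {v} σv≢v
    with any? (λ x → (x ∈? S) ×-dec ¬? (to σ x ≟ x))
  ... | yes found = found
  ... | no none = contradiction (det σ fixes v) σv≢v
    where
      fixes : ∀ x → x ∈ S → to σ x ≡ x
      fixes x x∈S = decidable-stable (to σ x ≟ x) (λ σx≢x → none (x , x∈S , σx≢x))

  module _ (simple : IsSimple Γ) (p q : Fin N) (agree : ∀ y → y ≢ p → y ≢ q → Γ p y ≡ Γ q y) where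
    private
      symm = proj₁ simple
      loopless = proj₂ simple

    transposeAut : Automorphism Γ
    transposeAut = record
      { to = transpose p q ; from = transpose q p
      ; from-to = λ _ → transpose-inverse q p ; to-from = λ _ → transpose-inverse p q
      ; adj = transpose-adj }
      where
        transpose-adj : ∀ x y → Γ (transpose p q x) (transpose p q y) ≡ Γ x y
        transpose-adj x y with transpose p q x | transposeView p q x | transpose p q y | transposeView p q y
        ... | _ | at-p | _ | at-p = trans (loopless q) (sym (loopless p))
        ... | _ | at-p | _ | at-q = symm q p
        ... | _ | at-p | _ | elsewhere y≢p y≢q = sym (agree y y≢p y≢q)
        ... | _ | at-q | _ | at-p = symm p q
        ... | _ | at-q | _ | at-q = trans (loopless p) (sym (loopless q))
        ... | _ | at-q | _ | elsewhere y≢p y≢q = agree y y≢p y≢q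
        ... | _ | elsewhere x≢p x≢q | _ | at-p =
          trans (symm x q) (trans (sym (agree x x≢p x≢q)) (symm p x))
        ... | _ | elsewhere x≢p x≢q | _ | at-q =
          trans (symm x p) (trans (agree x x≢p x≢q) (symm q x))
        ... | _ | elsewhere _ _ | _ | elsewhere _ _ = refl

    determining-meets-pair : ∀ {S} → Determining Γ S → p ≢ q → p ∈ S ⊎ q ∈ S
    determining-meets-pair det p≢q
      with determining-meets-support det transposeAut (p≢q ∘ sym ∘ subst (_≡ p) (transpose-fixˡ p q))
    ... | x , x∈S , moved with transpose p q x | transposeView p q x
    ...   | _ | at-p            = inj₁ x∈S
    ...   | _ | at-q            = inj₂ x∈S
    ...   | _ | elsewhere _ _   = contradiction refl moved

-- A copy of the private `layerAdj` of Defs, with which it is definitionally equal.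
layerAdj : ℕ → ℕ → Bool
layerAdj s r = ((s ≡ᵇ 0) ∧ (r ≡ᵇ 0)) ∨ (r ≡ᵇ suc s) ∨ (s ≡ᵇ suc r)

≡ᵇ-true⇒≡ : ∀ {m n} → (m ≡ᵇ n) ≡ true → m ≡ n
≡ᵇ-true⇒≡ {m} {n} e = ≡ᵇ⇒≡ m n (Equivalence.from T-≡ e)

layerAdj-sym : ∀ s r → layerAdj s r ≡ layerAdj r s
layerAdj-sym s r = cong₂ _∨_ (∧-comm (s ≡ᵇ 0) (r ≡ᵇ 0)) (∨-comm (r ≡ᵇ suc s) (s ≡ᵇ suc r))

layerAdj-up : ∀ s → layerAdj s (suc s) ≡ true
layerAdj-up s rewrite dec-true (s ℕ.≟ s) refl = ∨-zeroʳ _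

layerAdj-down : ∀ r → layerAdj (suc r) r ≡ true
layerAdj-down r = trans (layerAdj-sym (suc r) r) (layerAdj-up r)

layerAdj-pred : ∀ s → layerAdj s (ℕ.pred s) ≡ true
layerAdj-pred zero    = refl
layerAdj-pred (suc r) = layerAdj-down r

layerAdj⇒ : ∀ s r → layerAdj s r ≡ true → (s ≡ 0 × r ≡ 0) ⊎ r ≡ suc s ⊎ s ≡ suc r
layerAdj⇒ s r e with r ≡ᵇ suc s in r≡1+s | s ≡ᵇ suc r in s≡1+r
... | true  | _    = inj₂ (inj₁ (≡ᵇ-true⇒≡ r≡1+s))
... | false | true = inj₂ (inj₂ (≡ᵇ-true⇒≡ s≡1+r))
layerAdj⇒ zero    zero    _  | false | false = inj₁ (refl , refl)
layerAdj⇒ zero    (suc r) () | false | false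
layerAdj⇒ (suc s) r       () | false | false

toℕ-pred : ∀ {m} (s : Fin m) → toℕ (Fin.pred s) ≡ ℕ.pred (toℕ s)
toℕ-pred zero    = refl
toℕ-pred (suc s) = toℕ-inject₁ s

pred-inject₁≢suc : ∀ {m} (k : Fin m) → Fin.pred (inject₁ k) ≢ suc k
pred-inject₁≢suc k e = ℕP.<-irrefl
  (trans (sym (trans (toℕ-pred (inject₁ k)) (cong ℕ.pred (toℕ-inject₁ k)))) (cong toℕ e))
  (s≤s ℕP.pred[n]≤n)

inject₁-or-fromℕ : ∀ {m} (s : Fin (suc m)) → (∃[ k ] s ≡ inject₁ k) ⊎ s ≡ fromℕ m
inject₁-or-fromℕ {zero}  zero    = inj₂ refl
inject₁-or-fromℕ {suc m} zero    = inj₁ (zero , refl)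
inject₁-or-fromℕ {suc m} (suc s) with inject₁-or-fromℕ s
... | inj₁ (k , refl) = inj₁ (suc k , refl)
... | inj₂ refl       = inj₂ refl

isolated-twins : ∀ {n} {G : Graph n} {i j} → Isolated G i → Isolated G j → Twins G i j
isolated-twins i-isolated j-isolated k = trans (i-isolated k) (sym (j-isolated k))

module _ {n : ℕ} {G : Graph n} (twin-free : TwinFree G) {c : Fin n} (c-isolated : Isolated G c) where

  isolated-fixed : (τ : Automorphism G) → Iso.to τ c ≡ c
  isolated-fixed τ = twin-free _ _ (isolated-twins {G = G} (isolated-preserved τ c-isolated) c-isolated)

  has-neighbour : ∀ i → i ≢ c → ∃[ j ] G i j ≡ true
  has-neighbour i i≢c with any? (λ j → G i j Bool.≟ true)
  ... | yes found = found
  ... | no none   = contradiction (twin-free i c (isolated-twins {G = G} i-isolated c-isolated)) i≢c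
    where
      i-isolated : Isolated G i
      i-isolated j = ¬-not (λ gij → none (j , gij))

m∸n≤1+m∸[1+n] : ∀ m n → m ∸ n ≤ suc (m ∸ suc n)
m∸n≤1+m∸[1+n] zero    zero    = z≤n
m∸n≤1+m∸[1+n] zero    (suc n) = z≤n
m∸n≤1+m∸[1+n] (suc m) zero    = ≤-refl
m∸n≤1+m∸[1+n] (suc m) (suc n) = m∸n≤1+m∸[1+n] m n

module Mycielskian {n : ℕ} (G : Graph n) (t : ℕ) where

  N : ℕ
  N = suc (n * suc t)

  Γ : Graph N
  Γ = μ t G

  w : Fin N
  w = zero

  u : Fin n → Fin (suc t) → Fin N
  u i s = suc (combine i s)

  data Vertex : Fin N → Set where
    w-vertex : Vertex w
    u-vertex : ∀ i s → Vertex (u i s)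

  vertex : ∀ x → Vertex x
  vertex zero    = w-vertex
  vertex (suc x) = subst (Vertex ∘ suc) (combine-remQuot {n} (suc t) x) (u-vertex _ _)

  u-injective : ∀ {i j s r} → u i s ≡ u j r → i ≡ j × s ≡ r
  u-injective {i} {j} {s} {r} e = combine-injective i s j r (FinP.suc-injective e)

  w≢u : ∀ {i s} → w ≢ u i s
  w≢u ()

  μ-w-u : ∀ j r → Γ w (u j r) ≡ (toℕ r ≡ᵇ t)
  μ-w-u j r = cong (λ (p : Fin n × Fin (suc t)) → toℕ (proj₂ p) ≡ᵇ t) (remQuot-combine j r)

  μ-u-w : ∀ i s → Γ (u i s) w ≡ (toℕ s ≡ᵇ t)
  μ-u-w i s = cong (λ (p : Fin n × Fin (suc t)) → toℕ (proj₂ p) ≡ᵇ t) (remQuot-combine i s)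

  μ-u-u : ∀ i s j r → Γ (u i s) (u j r) ≡ G i j ∧ layerAdj (toℕ s) (toℕ r)
  μ-u-u i s j r = cong₂ (λ (p q : Fin n × Fin (suc t)) →
                            G (proj₁ p) (proj₁ q) ∧ layerAdj (toℕ (proj₂ p)) (toℕ (proj₂ q)))
    (remQuot-combine i s) (remQuot-combine j r)

  w-u-adjacent : ∀ {j r} → toℕ r ≡ t → Γ w (u j r) ≡ true
  w-u-adjacent {j} {r} r≡t = trans (μ-w-u j r) (dec-true (toℕ r ℕ.≟ t) r≡t)

  w-u-adjacent⇒top : ∀ {j r} → Γ w (u j r) ≡ true → toℕ r ≡ t
  w-u-adjacent⇒top {j} {r} e = ≡ᵇ-true⇒≡ (trans (sym (μ-w-u j r)) e)

  u-w-adjacent : ∀ {i s} → toℕ s ≡ t → Γ (u i s) w ≡ true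
  u-w-adjacent {i} {s} s≡t = trans (μ-u-w i s) (dec-true (toℕ s ℕ.≟ t) s≡t)

  u-w-nonadjacent : ∀ {i s} → toℕ s ≢ t → Γ (u i s) w ≡ false
  u-w-nonadjacent {i} {s} s≢t = trans (μ-u-w i s) (dec-false (toℕ s ℕ.≟ t) s≢t)

  u-u-adjacent : ∀ {i s j r} → G i j ≡ true → layerAdj (toℕ s) (toℕ r) ≡ true → Γ (u i s) (u j r) ≡ true
  u-u-adjacent {i} {s} {j} {r} gij lsr = trans (μ-u-u i s j r) (cong₂ _∧_ gij lsr)

  u-u-nonadjacent : ∀ {i j} → G i j ≡ false → ∀ s r → Γ (u i s) (u j r) ≡ false
  u-u-nonadjacent {i} {j} gij s r = trans (μ-u-u i s j r) (cong (_∧ _) gij)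

  μ-u-pred : ∀ i j s → Γ (u i s) (u j (Fin.pred s)) ≡ G i j
  μ-u-pred i j s = begin
    Γ (u i s) (u j (Fin.pred s))                  ≡⟨ μ-u-u i s j (Fin.pred s) ⟩
    G i j ∧ layerAdj (toℕ s) (toℕ (Fin.pred s))   ≡⟨ cong (λ r → G i j ∧ layerAdj (toℕ s) r) (toℕ-pred s) ⟩
    G i j ∧ layerAdj (toℕ s) (ℕ.pred (toℕ s))     ≡⟨ cong (G i j ∧_) (layerAdj-pred (toℕ s)) ⟩
    G i j ∧ true                                  ≡⟨ ∧-identityʳ (G i j) ⟩
    G i j                                         ∎
    where open ≡-Reasoning

  μ-u-suc : ∀ i j (k : Fin t) → Γ (u i (inject₁ k)) (u j (suc k)) ≡ G i j
  μ-u-suc i j k = begin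
    Γ (u i (inject₁ k)) (u j (suc k))                  ≡⟨ μ-u-u i (inject₁ k) j (suc k) ⟩
    G i j ∧ layerAdj (toℕ (inject₁ k)) (suc (toℕ k))
      ≡⟨ cong (λ m → G i j ∧ layerAdj m (suc (toℕ k))) (toℕ-inject₁ k) ⟩
    G i j ∧ layerAdj (toℕ k) (suc (toℕ k))            ≡⟨ cong (G i j ∧_) (layerAdj-up (toℕ k)) ⟩
    G i j ∧ true                                      ≡⟨ ∧-identityʳ (G i j) ⟩
    G i j                                             ∎
    where open ≡-Reasoning

  u-u-adjacent⇒layerAdj : ∀ {i s j r} → Γ (u i s) (u j r) ≡ true → layerAdj (toℕ s) (toℕ r) ≡ true
  u-u-adjacent⇒layerAdj {i} {s} {j} {r} e = ∧-conicalʳ (G i j) _ (trans (sym (μ-u-u i s j r)) e)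

  μ-simple : IsSimple G → IsSimple Γ
  μ-simple (symG , looplessG) = symm , loopless
    where
      symm-view : ∀ {x y} → Vertex x → Vertex y → Γ x y ≡ Γ y x
      symm-view w-vertex       w-vertex       = refl
      symm-view w-vertex       (u-vertex j r) = trans (μ-w-u j r) (sym (μ-u-w j r))
      symm-view (u-vertex i s) w-vertex       = trans (μ-u-w i s) (sym (μ-w-u i s))
      symm-view (u-vertex i s) (u-vertex j r) = begin
        Γ (u i s) (u j r)                         ≡⟨ μ-u-u i s j r ⟩
        G i j ∧ layerAdj (toℕ s) (toℕ r)          ≡⟨ cong₂ _∧_ (symG i j) (layerAdj-sym (toℕ s) (toℕ r)) ⟩
        G j i ∧ layerAdj (toℕ r) (toℕ s)          ≡⟨ sym (μ-u-u j r i s) ⟩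
        Γ (u j r) (u i s)                         ∎
        where open ≡-Reasoning

      symm : ∀ x y → Γ x y ≡ Γ y x
      symm x y = symm-view (vertex x) (vertex y)

      loopless-view : ∀ {x} → Vertex x → Γ x x ≡ false
      loopless-view w-vertex       = refl
      loopless-view (u-vertex i s) = u-u-nonadjacent (looplessG i) s s

      loopless : ∀ x → Γ x x ≡ false
      loopless x = loopless-view (vertex x)

  OnColumns : (Fin n → Fin (suc t) → Set) → Fin N → Set
  OnColumns P zero    = ⊥
  OnColumns P (suc x) = uncurry P (remQuot {n} (suc t) x)

  module _ {P : Fin n → Fin (suc t) → Set} (P? : ∀ i s → Dec (P i s)) where

    onColumns? : Decidable (OnColumns P)
    onColumns? zero    = no λ ()
    onColumns? (suc x) = uncurry P? (remQuot {n} (suc t) x)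

    columnwise : Subset N
    columnwise = decSubset onColumns?

    u∈columnwise⁺ : ∀ i s → P i s → u i s ∈ columnwise
    u∈columnwise⁺ i s p = ∈-decSubset⁺ onColumns? (subst (uncurry P) (sym (remQuot-combine i s)) p)

    u∈columnwise⁻ : ∀ {i s} → u i s ∈ columnwise → P i s
    u∈columnwise⁻ {i} {s} u∈ = subst (uncurry P) (remQuot-combine i s) (∈-decSubset⁻ onColumns? u∈)

    w∉columnwise : w ∉ columnwise
    w∉columnwise = ∈-decSubset⁻ onColumns?

    ∣columnwise∣≤ : ∀ {k} (f : ∀ {i s} → P i s → Fin k) →
                    (∀ {i s j r} (p : P i s) (q : P j r) → f p ≡ f q → u i s ≡ u j r) → ∣ columnwise ∣ ≤ k
    ∣columnwise∣≤ {k} f f-inj =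
      injective⇒∣p∣≤ (λ {x} → code (vertex x)) (λ {x} {y} → code-inj (vertex x) (vertex y))
      where
        code : ∀ {x} → Vertex x → x ∈ columnwise → Fin k
        code w-vertex       w∈ = ⊥-elim (w∉columnwise w∈)
        code (u-vertex i s) u∈ = f (u∈columnwise⁻ u∈)

        code-inj : ∀ {x y} (vx : Vertex x) (vy : Vertex y) x∈ y∈ → code vx x∈ ≡ code vy y∈ → x ≡ y
        code-inj w-vertex       _              w∈ _  _ = ⊥-elim (w∉columnwise w∈)
        code-inj (u-vertex _ _) w-vertex       _  w∈ _ = ⊥-elim (w∉columnwise w∈)
        code-inj (u-vertex _ _) (u-vertex _ _) x∈ y∈ e = f-inj (u∈columnwise⁻ x∈) (u∈columnwise⁻ y∈) e

  lift : (Fin n → Fin n) → Fin N → Fin N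
  lift f zero    = w
  lift f (suc x) = u (f (proj₁ (remQuot {n} (suc t) x))) (proj₂ (remQuot {n} (suc t) x))

  lift-u : ∀ f i s → lift f (u i s) ≡ u (f i) s
  lift-u f i s = cong (λ (p : Fin n × Fin (suc t)) → u (f (proj₁ p)) (proj₂ p)) (remQuot-combine i s)

  lift-inverse : ∀ {f g} → (∀ i → g (f i) ≡ i) → ∀ x → lift g (lift f x) ≡ x
  lift-inverse {f} {g} g∘f x = go (vertex x)
    where
      go : ∀ {x} → Vertex x → lift g (lift f x) ≡ x
      go w-vertex       = refl
      go (u-vertex i s) =
        trans (cong (lift g) (lift-u f i s)) (trans (lift-u g (f i) s) (cong (λ j → u j s) (g∘f i)))

  liftAut : Automorphism G → Automorphism Γ
  liftAut τ = record
    { to = lift (Iso.to τ) ; from = lift (Iso.from τ)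
    ; from-to = lift-inverse (Iso.from-to τ) ; to-from = lift-inverse (Iso.to-from τ)
    ; adj = λ x y → lift-adj (vertex x) (vertex y) }
    where
      f = Iso.to τ
      lift-adj : ∀ {x y} → Vertex x → Vertex y → Γ (lift f x) (lift f y) ≡ Γ x y
      lift-adj w-vertex       w-vertex       = refl
      lift-adj w-vertex       (u-vertex j r) =
        trans (cong (Γ w) (lift-u f j r)) (trans (μ-w-u (f j) r) (sym (μ-w-u j r)))
      lift-adj (u-vertex i s) w-vertex       =
        trans (cong (λ x → Γ x w) (lift-u f i s)) (trans (μ-u-w (f i) s) (sym (μ-u-w i s)))
      lift-adj (u-vertex i s) (u-vertex j r) = begin
        Γ (lift f (u i s)) (lift f (u j r))          ≡⟨ cong₂ Γ (lift-u f i s) (lift-u f j r) ⟩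
        Γ (u (f i) s) (u (f j) r)                    ≡⟨ μ-u-u (f i) s (f j) r ⟩
        G (f i) (f j) ∧ layerAdj (toℕ s) (toℕ r)     ≡⟨ cong (_∧ _) (Iso.adj τ i j) ⟩
        G i j ∧ layerAdj (toℕ s) (toℕ r)             ≡⟨ sym (μ-u-u i s j r) ⟩
        Γ (u i s) (u j r)                            ∎
        where open ≡-Reasoning

  -- Outside the columns of isolated vertices of G, depth x is the distance from w to x.
  depth : Fin N → ℕ
  depth zero    = 0
  depth (suc x) = suc (t ∸ toℕ (proj₂ (remQuot {n} (suc t) x)))

  depth-u : ∀ i s → depth (u i s) ≡ suc (t ∸ toℕ s)
  depth-u i s = cong (λ (p : Fin n × Fin (suc t)) → suc (t ∸ toℕ (proj₂ p))) (remQuot-combine i s)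

  Walk : ℕ → Fin N → Set
  Walk zero    x = x ≡ w
  Walk (suc k) x = ∃[ y ] Walk k y × Γ y x ≡ true

  walk-preserved : (σ : Automorphism Γ) → Iso.to σ w ≡ w → ∀ {k x} → Walk k x → Walk k (Iso.to σ x)
  walk-preserved σ σw≡w {zero}  refl            = σw≡w
  walk-preserved σ σw≡w {suc k} (y , walk , yx) =
    Iso.to σ y , walk-preserved σ σw≡w walk , trans (Iso.adj σ y _) yx

  depth-edge : ∀ {x y} → Γ y x ≡ true → depth x ≤ suc (depth y)
  depth-edge {x} {y} = go (vertex y) (vertex x)
    where
      go : ∀ {x y} → Vertex y → Vertex x → Γ y x ≡ true → depth x ≤ suc (depth y)
      go w-vertex       w-vertex       ()
      go w-vertex       (u-vertex j r) e
        rewrite depth-u j r | w-u-adjacent⇒top {j} {r} e | n∸n≡0 t = ≤-refl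
      go (u-vertex i s) w-vertex       _ = z≤n
      go (u-vertex i s) (u-vertex j r) e
        rewrite depth-u i s | depth-u j r with layerAdj⇒ (toℕ s) (toℕ r) (u-u-adjacent⇒layerAdj e)
      ... | inj₁ (s≡0 , r≡0)  rewrite s≡0 | r≡0 = s≤s (n≤1+n _)
      ... | inj₂ (inj₁ r≡1+s) rewrite r≡1+s = s≤s (≤-trans (∸-monoʳ-≤ t (n≤1+n (toℕ s))) (n≤1+n _))
      ... | inj₂ (inj₂ s≡1+r) rewrite s≡1+r = s≤s (m∸n≤1+m∸[1+n] t (toℕ r))

  depth≤walk : ∀ {k x} → Walk k x → depth x ≤ k
  depth≤walk {zero}  refl            = z≤n
  depth≤walk {suc k} (y , walk , yx) = ≤-trans (depth-edge yx) (s≤s (depth≤walk walk))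

  depth-preserved : (σ : Automorphism Γ) → Iso.to σ w ≡ w → ∀ {x} →
                    Walk (depth x) x → Walk (depth (Iso.to σ x)) (Iso.to σ x) → depth (Iso.to σ x) ≡ depth x
  depth-preserved σ σw≡w {x} x-walk σx-walk = ≤-antisym
    (depth≤walk (walk-preserved σ σw≡w x-walk))
    (depth≤walk (subst (Walk _) (Iso.from-to σ x) (walk-preserved (σ ⁻¹) σ⁻¹w≡w σx-walk)))
    where
      σ⁻¹w≡w : Iso.from σ w ≡ w
      σ⁻¹w≡w = trans (cong (Iso.from σ) (sym σw≡w)) (Iso.from-to σ w)

  depth-u-injective : ∀ {i j s r} → depth (u i s) ≡ depth (u j r) → s ≡ r
  depth-u-injective {i} {j} {s} {r} e = toℕ-injective (∸-cancelˡ-≡ (toℕ≤pred[n] s) (toℕ≤pred[n] r)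
    (ℕP.suc-injective (trans (sym (depth-u i s)) (trans e (depth-u j r)))))

  walk-to-u : (∀ i j → G i j ≡ G j i) → ∀ {i j} → G i j ≡ true → ∀ s → Walk (depth (u i s)) (u i s)
  walk-to-u symG {i} {j} gij s = subst (λ k → Walk k (u i s)) (sym (depth-u i s)) (go _ gij s refl)
    where
      go : ∀ d {i j} → G i j ≡ true → ∀ s → t ∸ toℕ s ≡ d → Walk (suc d) (u i s)
      go zero    _ s t∸s≡0 =
        w , refl , w-u-adjacent (≤-antisym (toℕ≤pred[n] s) (m∸n≡0⇒m≤n t∸s≡0))
      go (suc d) {i} {j} gij s t∸s≡1+d =
        u j s⁺ , go d (trans (symG j i) gij) s⁺ t∸s⁺≡d , u-u-adjacent (trans (symG j i) gij) above
        where
          s<t : toℕ s < t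
          s<t = m∸n≢0⇒n<m (λ e → ℕP.1+n≢0 (trans (sym t∸s≡1+d) e))
          s⁺ : Fin (suc t)
          s⁺ = fromℕ< (s≤s s<t)
          t∸s⁺≡d : t ∸ toℕ s⁺ ≡ d
          t∸s⁺≡d rewrite toℕ-fromℕ< (s≤s s<t) =
            trans (sym (pred[m∸n]≡m∸[1+n] t (toℕ s))) (cong ℕ.pred t∸s≡1+d)
          above : layerAdj (toℕ s⁺) (toℕ s) ≡ true
          above =
            subst (λ k → layerAdj k (toℕ s) ≡ true) (sym (toℕ-fromℕ< (s≤s s<t))) (layerAdj-down (toℕ s))

module IsolatedColumn {n : ℕ} (G : Graph n) (t₀ : ℕ) (simple : IsSimple G)
  (c : Fin n) (c-isolated : Isolated G c) (neighbour : ∀ i → i ≢ c → ∃[ j ] G i j ≡ true) where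

  t : ℕ
  t = suc t₀

  open Mycielskian G t public
  open Iso

  Γ-simple : IsSimple Γ
  Γ-simple = μ-simple simple

  iso : Fin t → Fin N
  iso k = u c (inject₁ k)

  pendant : Fin N
  pendant = u c (fromℕ t)

  iso-injective : ∀ {k l} → iso k ≡ iso l → k ≡ l
  iso-injective = inject₁-injective ∘ proj₂ ∘ u-injective

  iso-isolated : ∀ k → Isolated Γ (iso k)
  iso-isolated k y with vertex y
  ... | w-vertex       = u-w-nonadjacent (toℕ-inject₁-≢ k ∘ sym)
  ... | u-vertex j r   = u-u-nonadjacent (c-isolated j) (inject₁ k) r

  u-not-isolated : ∀ {i} → i ≢ c → ∀ s → ¬ Isolated Γ (u i s)
  u-not-isolated {i} i≢c s with neighbour i i≢c
  ... | j , gij = adjacent⇒¬isolated {Γ = Γ} (u i s) (u j (Fin.pred s)) (trans (μ-u-pred i j s) gij)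

  isolated⇒iso : ∀ {x} → Isolated Γ x → ∃[ k ] x ≡ iso k
  isolated⇒iso {x} = go (vertex x)
    where
      go : ∀ {x} → Vertex x → Isolated Γ x → ∃[ k ] x ≡ iso k
      go w-vertex w-isolated =
        ⊥-elim (adjacent⇒¬isolated {Γ = Γ} w pendant (w-u-adjacent {c} (toℕ-fromℕ t)) w-isolated)
      go (u-vertex i s) u-isolated with i ≟ c | inject₁-or-fromℕ s
      ... | no i≢c   | _               = ⊥-elim (u-not-isolated i≢c s u-isolated)
      ... | yes refl | inj₁ (k , refl) = k , refl
      ... | yes refl | inj₂ refl       =
        ⊥-elim (adjacent⇒¬isolated {Γ = Γ} pendant w (u-w-adjacent (toℕ-fromℕ t)) u-isolated)

  w≢pendant : w ≢ pendant
  w≢pendant = w≢u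

  w≢iso : ∀ {k} → w ≢ iso k
  w≢iso = w≢u

  pendant≢iso : ∀ {k} → pendant ≢ iso k
  pendant≢iso = fromℕ≢inject₁ ∘ proj₂ ∘ u-injective

  pendant-uniqueNeighbour : UniqueNeighbour Γ pendant w
  pendant-uniqueNeighbour = uniqueNeighbour (u-w-adjacent (toℕ-fromℕ t)) λ y → go (vertex y)
    where
      go : ∀ {y} → Vertex y → Γ pendant y ≡ true → y ≡ w
      go w-vertex       _ = refl
      go (u-vertex j r) e with () ← trans (sym e) (u-u-nonadjacent (c-isolated j) (fromℕ t) r)

  determining-contains-isos : ∀ {S} → Determining Γ S → ∃[ m ] ∀ k → iso (punchIn m k) ∈ S
  determining-contains-isos {S} det with any? (λ m → ¬? (iso m ∈? S))
  ... | yes (m , iso-m∉S) = m , λ k → [ flip contradiction iso-m∉S , id ]′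
        (determining-meets-pair Γ-simple (iso m) (iso (punchIn m k)) (isos-agree m (punchIn m k)) det
          (punchInᵢ≢i m k ∘ sym ∘ iso-injective))
    where
      isos-agree : ∀ k l y → y ≢ iso k → y ≢ iso l → Γ (iso k) y ≡ Γ (iso l) y
      isos-agree k l y _ _ = trans (iso-isolated k y) (sym (iso-isolated l y))
  ... | no none = zero , λ k → decidable-stable (_ ∈? S) (λ iso∉S → none (_ , iso∉S))

  iso-fixed : (σ : Automorphism Γ) (m : Fin t) → (∀ k → to σ (iso (punchIn m k)) ≡ iso (punchIn m k)) →
              ∀ k → to σ (iso k) ≡ iso k
  iso-fixed σ m fixed = fixed-everywhere
    where
      fixed-elsewhere : ∀ {k} → m ≢ k → to σ (iso k) ≡ iso k
      fixed-elsewhere m≢k = subst (λ l → to σ (iso l) ≡ iso l) (punchIn-punchOut m≢k) (fixed _)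

      fixed-at-m : to σ (iso m) ≡ iso m
      fixed-at-m with isolated⇒iso (isolated-preserved σ (iso-isolated m))
      ... | k , σm≡k with m ≟ k
      ...   | yes refl = σm≡k
      ...   | no m≢k   =
        contradiction (iso-injective (Aut-injective σ (trans σm≡k (sym (fixed-elsewhere m≢k))))) m≢k

      fixed-everywhere : ∀ k → to σ (iso k) ≡ iso k
      fixed-everywhere k with m ≟ k
      ... | yes refl = fixed-at-m
      ... | no m≢k   = fixed-elsewhere m≢k

Fin1-equal : (i j : Fin 1) → i ≡ j
Fin1-equal zero zero = refl

module SingleVertex (G : Graph 1) (t₀ : ℕ) (simple : IsSimple G) where

  c-isolated : Isolated G zero
  c-isolated zero = proj₂ simple zero

  open IsolatedColumn G t₀ simple zero c-isolated (λ i i≢0 → ⊥-elim (i≢0 (Fin1-equal i zero)))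
  open Iso

  w-pendant-agree : ∀ y → y ≢ w → y ≢ pendant → Γ w y ≡ Γ pendant y
  w-pendant-agree y y≢w y≢pendant with vertex y
  ... | w-vertex     = ⊥-elim (y≢w refl)
  ... | u-vertex j r =
    trans (μ-w-u j r) (trans (dec-false (toℕ r ℕ.≟ t) r≢t) (sym (u-u-nonadjacent (c-isolated j) (fromℕ t) r)))
    where
      r≢t : toℕ r ≢ t
      r≢t r≡t = y≢pendant (cong₂ u (Fin1-equal j zero) (toℕ-injective (trans r≡t (sym (toℕ-fromℕ t)))))

  lower-bound : ∀ S → Determining Γ S → t ≤ ∣ S ∣
  lower-bound S det with determining-contains-isos det | non-iso∈S
    where
      non-iso∈S : ∃[ x ] x ∈ S × (∀ {k} → x ≢ iso k)
      non-iso∈S = [ (λ w∈S → w , w∈S , λ {k} → w≢iso)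
                  , (λ pendant∈S → pendant , pendant∈S , λ {k} → pendant≢iso) ]′
        (determining-meets-pair Γ-simple w pendant w-pendant-agree det w≢pendant)
  ... | m , isos∈S | x , x∈S , x≢iso = injective⇒≤∣p∣ f f-injective f∈S
    where
      f : Fin t → Fin N
      f zero    = x
      f (suc k) = iso (punchIn m k)

      f-injective : ∀ {k l} → f k ≡ f l → k ≡ l
      f-injective {zero}  {zero}  _ = refl
      f-injective {zero}  {suc l} e = ⊥-elim (x≢iso e)
      f-injective {suc k} {zero}  e = ⊥-elim (x≢iso (sym e))
      f-injective {suc k} {suc l} e = cong suc (punchIn-injective m k l (iso-injective e))

      f∈S : ∀ k → f k ∈ S
      f∈S zero    = x∈S
      f∈S (suc k) = isos∈S k

  Chosen : Fin 1 → Fin (suc t) → Set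
  Chosen _ s = (∃[ k ] s ≡ inject₁ (punchIn zero k)) ⊎ s ≡ fromℕ t

  chosen? : ∀ i s → Dec (Chosen i s)
  chosen? _ s = any? (λ k → s ≟ inject₁ (punchIn zero k)) ⊎-dec (s ≟ fromℕ t)

  S₁ : Subset N
  S₁ = columnwise chosen?

  ∣S₁∣≤t : ∣ S₁ ∣ ≤ t
  ∣S₁∣≤t = ∣columnwise∣≤ chosen? (λ {i} {s} → code {i} {s}) code-injective
    where
      code : ∀ {i s} → Chosen i s → Fin t
      code (inj₁ (k , _)) = punchIn zero k
      code (inj₂ _)       = zero

      code-injective : ∀ {i s j r} (p : Chosen i s) (q : Chosen j r) →
                       code {i} {s} p ≡ code {j} {r} q → u i s ≡ u j r
      code-injective {i} {j = j} (inj₁ (k , refl)) (inj₁ (l , refl)) e =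
        cong₂ u (Fin1-equal i j) (cong (inject₁ ∘ punchIn zero) (punchIn-injective zero k l e))
      code-injective {i} {j = j} (inj₂ refl)       (inj₂ refl)       _ = cong₂ u (Fin1-equal i j) refl

  S₁-determining : Determining Γ S₁
  S₁-determining σ fixes v = go (vertex v)
    where
      pendant-fixed : to σ pendant ≡ pendant
      pendant-fixed = fixes pendant (u∈columnwise⁺ chosen? zero (fromℕ t) (inj₂ refl))

      go : ∀ {v} → Vertex v → to σ v ≡ v
      go w-vertex = uniqueNeighbour-fixed σ pendant-uniqueNeighbour pendant-fixed
      go (u-vertex zero s) with inject₁-or-fromℕ s
      ... | inj₁ (k , refl) =
        iso-fixed σ zero (λ k → fixes _ (u∈columnwise⁺ chosen? zero _ (inj₁ (k , refl)))) k
      ... | inj₂ refl       = pendant-fixed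

  det-μ : IsDet Γ t
  det-μ = isDet-intro S₁ S₁-determining ∣S₁∣≤t lower-bound

  det-G : IsDet G 0
  det-G = isDet-intro ∅ (λ σ _ v → Fin1-equal _ _) (ℕP.≤-reflexive (∣⊥∣≡0 1)) (λ _ _ → z≤n)

module TwinFreeWithIsolatedVertex {n : ℕ} (G : Graph n) (t₀ : ℕ) (simple : IsSimple G)
  (twin-free : TwinFree G) (c : Fin n) (c-isolated : Isolated G c) (a : Fin n) (a≢c : a ≢ c) where

  neighbour : ∀ i → i ≢ c → ∃[ j ] G i j ≡ true
  neighbour = has-neighbour twin-free c-isolated

  open IsolatedColumn G t₀ simple c c-isolated neighbour
  open Iso

  c-isolatedʳ : ∀ k → G k c ≡ false
  c-isolatedʳ k = trans (proj₁ simple k c) (c-isolated k)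

  uniqueNeighbour⇒pendant : ∀ {x z} → UniqueNeighbour Γ x z → x ≡ pendant
  uniqueNeighbour⇒pendant {x} {z} x-unique with vertex x
  ... | w-vertex = contradiction
    (uniqueNeighbour-equal x-unique (w-u-adjacent {c} (toℕ-fromℕ t)) (w-u-adjacent {a} (toℕ-fromℕ t)))
    (a≢c ∘ sym ∘ proj₁ ∘ u-injective)
  ... | u-vertex i s with i ≟ c | inject₁-or-fromℕ s
  ...   | yes refl | inj₂ refl       = refl
  ...   | yes refl | inj₁ (k , refl) =
    ⊥-elim (adjacent⇒¬isolated {Γ = Γ} (iso k) z (UniqueNeighbour.adjacent x-unique) (iso-isolated k))
  ...   | no i≢c   | inj₂ refl with neighbour i i≢c
  ...     | j , gij = contradiction
    (uniqueNeighbour-equal x-unique (u-w-adjacent (toℕ-fromℕ t)) (trans (μ-u-pred i j _) gij))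
    w≢u
  uniqueNeighbour⇒pendant x-unique | u-vertex i s | no i≢c | inj₁ (k , refl) with neighbour i i≢c
  ...     | j , gij = contradiction
    (uniqueNeighbour-equal x-unique (trans (μ-u-pred i j _) gij) (trans (μ-u-suc i j k) gij))
    (pred-inject₁≢suc k ∘ proj₂ ∘ u-injective)

  pendant-fixed : (σ : Automorphism Γ) → to σ pendant ≡ pendant
  pendant-fixed σ = uniqueNeighbour⇒pendant (uniqueNeighbour-preserved σ pendant-uniqueNeighbour)

  w-fixed : (σ : Automorphism Γ) → to σ w ≡ w
  w-fixed σ = uniqueNeighbour-fixed σ pendant-uniqueNeighbour (pendant-fixed σ)

  layer-preserved : (σ : Automorphism Γ) → ∀ {i} → i ≢ c → ∀ s → ∃[ j ] j ≢ c × to σ (u i s) ≡ u j s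
  layer-preserved σ {i} i≢c s = go (vertex (to σ (u i s))) refl
    where
      walk-to : ∀ {i} → i ≢ c → ∀ s → Walk (depth (u i s)) (u i s)
      walk-to i≢c = walk-to-u (proj₁ simple) (proj₂ (neighbour _ i≢c))

      go : ∀ {y} → Vertex y → to σ (u i s) ≡ y → ∃[ j ] j ≢ c × to σ (u i s) ≡ u j s
      go w-vertex e = ⊥-elim (w≢u (Aut-injective σ (trans (w-fixed σ) (sym e))))
      go (u-vertex j r) e with j ≟ c | inject₁-or-fromℕ r
      ... | yes refl | inj₁ (k , refl) =
        ⊥-elim (u-not-isolated i≢c s (isolated-reflected σ (subst (Isolated Γ) (sym e) (iso-isolated k))))
      ... | yes refl | inj₂ refl       =
        ⊥-elim (i≢c (proj₁ (u-injective (Aut-injective σ (trans e (sym (pendant-fixed σ)))))))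
      ... | no j≢c   | _               = j , j≢c , trans e (cong (u j) (sym (depth-u-injective same-depth)))
        where
          same-depth : depth (u i s) ≡ depth (u j r)
          same-depth = trans (sym (depth-preserved σ (w-fixed σ) (walk-to i≢c s)
            (subst (λ y → Walk (depth y) y) (sym e) (walk-to j≢c r)))) (cong depth e)

  π : Automorphism Γ → Fin n → Fin n
  π σ i with i ≟ c
  ... | yes _   = c
  ... | no i≢c = proj₁ (layer-preserved σ i≢c zero)

  π-c : ∀ σ → π σ c ≡ c
  π-c σ with c ≟ c
  ... | yes _   = refl
  ... | no c≢c = contradiction refl c≢c

  π-spec : ∀ σ {i} → i ≢ c → π σ i ≢ c × to σ (u i zero) ≡ u (π σ i) zero
  π-spec σ {i} i≢c with i ≟ c
  ... | yes i≡c  = contradiction i≡c i≢c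
  ... | no i≢c′ = proj₂ (layer-preserved σ i≢c′ zero)

  π-inverse : ∀ σ τ → (∀ x → to τ (to σ x) ≡ x) → ∀ i → π τ (π σ i) ≡ i
  π-inverse σ τ τ∘σ i = by-cases (i ≟ c)
    where
      by-cases : Dec (i ≡ c) → π τ (π σ i) ≡ i
      by-cases (yes refl) = trans (cong (π τ) (π-c σ)) (π-c τ)
      by-cases (no i≢c)   = sym (proj₁ (u-injective (begin
        u i zero                        ≡⟨ sym (τ∘σ (u i zero)) ⟩
        to τ (to σ (u i zero))          ≡⟨ cong (to τ) (proj₂ (π-spec σ i≢c)) ⟩
        to τ (u (π σ i) zero)           ≡⟨ proj₂ (π-spec τ (proj₁ (π-spec σ i≢c))) ⟩
        u (π τ (π σ i)) zero            ∎)))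
        where open ≡-Reasoning

  π-adj : ∀ σ i j → G (π σ i) (π σ j) ≡ G i j
  π-adj σ i j = by-cases (i ≟ c) (j ≟ c)
    where
      by-cases : Dec (i ≡ c) → Dec (j ≡ c) → G (π σ i) (π σ j) ≡ G i j
      by-cases (yes refl) _          =
        trans (cong (λ k → G k (π σ j)) (π-c σ)) (trans (c-isolated _) (sym (c-isolated j)))
      by-cases (no _)     (yes refl) =
        trans (cong (G (π σ i)) (π-c σ)) (trans (c-isolatedʳ _) (sym (c-isolatedʳ i)))
      by-cases (no i≢c)   (no j≢c)   = begin
        G (π σ i) (π σ j)                          ≡⟨ sym (μ-u-pred (π σ i) (π σ j) zero) ⟩
        Γ (u (π σ i) zero) (u (π σ j) zero)        ≡⟨ sym (cong₂ Γ (proj₂ (π-spec σ i≢c)) (proj₂ (π-spec σ j≢c))) ⟩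
        Γ (to σ (u i zero)) (to σ (u j zero))      ≡⟨ adj σ (u i zero) (u j zero) ⟩
        Γ (u i zero) (u j zero)                    ≡⟨ μ-u-pred i j zero ⟩
        G i j                                      ∎
        where open ≡-Reasoning

  πAut : Automorphism Γ → Automorphism G
  πAut σ = record
    { to = π σ ; from = π (σ ⁻¹)
    ; from-to = π-inverse σ (σ ⁻¹) (from-to σ) ; to-from = π-inverse (σ ⁻¹) σ (to-from σ)
    ; adj = π-adj σ }

  columns-fixed : (σ : Automorphism Γ) → (∀ {i} → i ≢ c → to σ (u i zero) ≡ u i zero) →
                  ∀ {i} → i ≢ c → ∀ s → to σ (u i s) ≡ u i s
  columns-fixed σ base-fixed i≢c s = go (toℕ s) s refl i≢c
    where
      go : ∀ k s → toℕ s ≡ k → ∀ {i} → i ≢ c → to σ (u i s) ≡ u i s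
      go zero    zero _ i≢c = base-fixed i≢c
      go (suc k) s s≡1+k {i} i≢c with layer-preserved σ i≢c s
      ... | j , j≢c , σuᵢ≡uⱼ = trans σuᵢ≡uⱼ (cong (λ l → u l s) (twin-free j i twins))
        where
          below-fixed : ∀ {m} → m ≢ c → to σ (u m (Fin.pred s)) ≡ u m (Fin.pred s)
          below-fixed = go k (Fin.pred s) (trans (toℕ-pred s) (cong ℕ.pred s≡1+k))

          twins : Twins G j i
          twins m with m ≟ c
          ... | yes refl = trans (c-isolatedʳ j) (sym (c-isolatedʳ i))
          ... | no m≢c   = begin
            G j m                                           ≡⟨ sym (μ-u-pred j m s) ⟩
            Γ (u j s) (u m (Fin.pred s))                    ≡⟨ sym (cong₂ Γ σuᵢ≡uⱼ (below-fixed m≢c)) ⟩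
            Γ (to σ (u i s)) (to σ (u m (Fin.pred s)))      ≡⟨ adj σ (u i s) (u m (Fin.pred s)) ⟩
            Γ (u i s) (u m (Fin.pred s))                    ≡⟨ μ-u-pred i m s ⟩
            G i m                                           ∎
            where open ≡-Reasoning

  Projected : Subset N → Fin n → Set
  Projected S i = i ≢ c × ∃[ s ] u i s ∈ S

  projected? : ∀ S → Decidable (Projected S)
  projected? S i = ¬? (i ≟ c) ×-dec any? (λ s → u i s ∈? S)

  projection : Subset N → Subset n
  projection S = decSubset (projected? S)

  projection-determining : ∀ {S} → Determining Γ S → Determining G (projection S)
  projection-determining {S} det τ fixes v = proj₁ (u-injective (trans (sym (lift-u (to τ) v zero))
    (det (liftAut τ) (λ x x∈S → lift-fixes (vertex x) x∈S) (u v zero))))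
    where
      lift-fixes : ∀ {x} → Vertex x → x ∈ S → lift (to τ) x ≡ x
      lift-fixes w-vertex       _     = refl
      lift-fixes (u-vertex i s) u∈S with i ≟ c
      ... | yes refl = trans (lift-u (to τ) c s) (cong (λ j → u j s) (isolated-fixed twin-free c-isolated τ))
      ... | no i≢c   = trans (lift-u (to τ) i s) (cong (λ j → u j s)
                         (fixes i (∈-decSubset⁺ (projected? S) (i≢c , s , u∈S))))

  ∣projection∣+t₀≤ : ∀ {S} → Determining Γ S → ∣ projection S ∣ + t₀ ≤ ∣ S ∣
  ∣projection∣+t₀≤ {S} det with determining-contains-isos det
  ... | m , isos∈S = ⊎-injective⇒≤∣p∣ f f-injective f∈S
    where
      projected : ∀ k → Projected S (enum (projection S) k)
      projected k = ∈-decSubset⁻ (projected? S) (enum-∈ (projection S) k)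

      f : Fin ∣ projection S ∣ ⊎ Fin t₀ → Fin N
      f (inj₁ k) = u (enum (projection S) k) (proj₁ (proj₂ (projected k)))
      f (inj₂ k) = iso (punchIn m k)

      f-injective : ∀ {x y} → f x ≡ f y → x ≡ y
      f-injective {inj₁ k} {inj₁ l} e = cong inj₁ (enum-injective (projection S) (proj₁ (u-injective e)))
      f-injective {inj₁ k} {inj₂ l} e = ⊥-elim (proj₁ (projected k) (proj₁ (u-injective e)))
      f-injective {inj₂ k} {inj₁ l} e = ⊥-elim (proj₁ (projected l) (sym (proj₁ (u-injective e))))
      f-injective {inj₂ k} {inj₂ l} e = cong inj₂ (punchIn-injective m k l (iso-injective e))

      f∈S : ∀ x → f x ∈ S
      f∈S (inj₁ k) = proj₂ (proj₂ (projected k))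
      f∈S (inj₂ k) = isos∈S k

  lower-bound : ∀ {d} → (∀ S′ → Determining G S′ → d ≤ ∣ S′ ∣) → ∀ S → Determining Γ S → d + t₀ ≤ ∣ S ∣
  lower-bound minimal S det =
    ≤-trans (ℕP.+-monoˡ-≤ t₀ (minimal _ (projection-determining det))) (∣projection∣+t₀≤ det)

  module Extension (SG : Subset n) where

    Chosen : Fin n → Fin (suc t) → Set
    Chosen i s = (s ≡ zero × i ∈ SG) ⊎ (i ≡ c × ∃[ k ] s ≡ inject₁ (punchIn zero k))

    chosen? : ∀ i s → Dec (Chosen i s)
    chosen? i s = ((s ≟ zero) ×-dec (i ∈? SG)) ⊎-dec ((i ≟ c) ×-dec any? (λ k → s ≟ inject₁ (punchIn zero k)))

    extension : Subset N
    extension = columnwise chosen?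

    ∣extension∣≤ : ∣ extension ∣ ≤ ∣ SG ∣ + t₀
    ∣extension∣≤ = ∣columnwise∣≤ chosen? (λ p → join ∣ SG ∣ t₀ (tag p))
                                        (λ p q → tag-injective p q ∘ join-injective ∣ SG ∣ t₀)
      where
        tag : ∀ {i s} → Chosen i s → Fin ∣ SG ∣ ⊎ Fin t₀
        tag (inj₁ (_ , i∈SG))  = inj₁ (rank i∈SG)
        tag (inj₂ (_ , k , _)) = inj₂ k

        tag-injective : ∀ {i s j r} (p : Chosen i s) (q : Chosen j r) → tag p ≡ tag q → u i s ≡ u j r
        tag-injective (inj₁ (refl , i∈SG))     (inj₁ (refl , j∈SG))     e    =
          cong (λ i → u i zero) (rank-injective i∈SG j∈SG (inj₁-injective e))
        tag-injective (inj₂ (refl , k , refl)) (inj₂ (refl , l , refl)) refl = refl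

    extension-determining : Determining G SG → Determining Γ extension
    extension-determining SG-determining σ fixes v = go (vertex v)
      where
        fixes-chosen : ∀ {i s} → Chosen i s → to σ (u i s) ≡ u i s
        fixes-chosen p = fixes _ (u∈columnwise⁺ chosen? _ _ p)

        π-fixes-SG : ∀ i → i ∈ SG → π σ i ≡ i
        π-fixes-SG i i∈SG = by-cases (i ≟ c)
          where
            by-cases : Dec (i ≡ c) → π σ i ≡ i
            by-cases (yes refl) = π-c σ
            by-cases (no i≢c)   = sym (proj₁ (u-injective
              (trans (sym (fixes-chosen (inj₁ (refl , i∈SG)))) (proj₂ (π-spec σ i≢c)))))

        base-fixed : ∀ {i} → i ≢ c → to σ (u i zero) ≡ u i zero
        base-fixed {i} i≢c =
          trans (proj₂ (π-spec σ i≢c)) (cong (λ j → u j zero) (SG-determining (πAut σ) π-fixes-SG i))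

        go : ∀ {v} → Vertex v → to σ v ≡ v
        go w-vertex = w-fixed σ
        go (u-vertex i s) with i ≟ c | inject₁-or-fromℕ s
        ... | no i≢c   | _               = columns-fixed σ base-fixed i≢c s
        ... | yes refl | inj₁ (k , refl) = iso-fixed σ zero (λ k → fixes-chosen (inj₂ (refl , k , refl))) k
        ... | yes refl | inj₂ refl       = pendant-fixed σ

  det-μ : ∀ {d} → IsDet G d → IsDet Γ (d + t₀)
  det-μ ((SG , SG-determining , ∣SG∣≡d) , minimal) =
    isDet-intro extension (extension-determining SG-determining)
      (subst (λ m → ∣ extension ∣ ≤ m + t₀) ∣SG∣≡d ∣extension∣≤) (lower-bound minimal)
    where open Extension SG

module _ {n m : ℕ} {G : Graph n} {H : Graph m} (φ : Iso G (H +K₁)) where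
  open Iso φ

  +K₁-isolated : Isolated G (from zero)
  +K₁-isolated k = trans (sym (adj (from zero) k)) (cong (λ x → (H +K₁) x (to k)) (to-from zero))

  +K₁-distinct : ∀ i → from (suc i) ≢ from zero
  +K₁-distinct i e with () ← trans (sym (to-from (suc i))) (trans (cong to e) (to-from zero))

theorem3p6 : ∀ {n : ℕ} (G : Graph n) (t : ℕ) → 1 ≤ t → IsSimple G → TwinFree G →
    ((n ≡ 1 → IsDet G 0 × IsDet (μ t G) t) ×
     ((Σ ℕ λ m → Σ (Graph m) λ H → IsSimple H × HasEdge H × Iso G (H +K₁)) →
      ∀ (d : ℕ) → IsDet G d → IsDet (μ t G) (d + t ∸ 1)))
theorem3p6 {n} G (suc t₀) (s≤s z≤n) simple twin-free = single-vertex , isolated-vertex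
  where
    single-vertex : n ≡ 1 → IsDet G 0 × IsDet (μ (suc t₀) G) (suc t₀)
    single-vertex refl = SingleVertex.det-G G t₀ simple , SingleVertex.det-μ G t₀ simple

    isolated-vertex : (Σ ℕ λ m → Σ (Graph m) λ H → IsSimple H × HasEdge H × Iso G (H +K₁)) →
                      ∀ d → IsDet G d → IsDet (μ (suc t₀) G) (d + suc t₀ ∸ 1)
    isolated-vertex (_ , _ , _ , (a , _) , φ) d det-G =
      subst (λ k → IsDet (μ (suc t₀) G) (k ∸ 1)) (sym (ℕP.+-suc d t₀))
        (TwinFreeWithIsolatedVertex.det-μ G t₀ simple twin-free _ (+K₁-isolated φ) _ (+K₁-distinct φ a) det-G)
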